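{- Let $T$ be a numerical semigroup, $d\ge1$, and let $S=\{\mathbf{a}\in\mathbb{N}^d:|\mathbf{a}|\in T\}$ be the $T$-graded GNS. For $k\in\mathbb{N}$ let $G_k=\{\mathbf{x}\in\mathbb{N}^d:|\mathbf{x}|=k\}$. Then $\operatorname{n}(S)=\sum_{i\in\operatorname{N}(T)}|G_i|$.
   Context: $\mathbb{N}$ is the set of non-negative integers; $|\mathbf{x}|$ is the sum of coordinates; $\le$ is the componentwise partial order on $\mathbb{N}^d$. For a GNS $S\subseteq\mathbb{N}^d$ (submonoid with finite complement $\operatorname{H}(S)$; numerical semigroup when $d=1$): $\operatorname{N}(S)=\{\mathbf{s}\in S:\mathbf{s}\le\mathbf{h}\text{ for some }\mathbf{h}\in\operatorname{H}(S)\}$ and $\operatorname{n}(S)=|\operatorname{N}(S)|$. -}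

module Defs where

open import Data.Nat using (ℕ; _+_; _≤_; _<_)
open import Data.Vec using (Vec; foldr)
open import Data.Vec.Relation.Binary.Pointwise.Inductive using (Pointwise)
open import Data.List using (List; length)
open import Data.List.Membership.Propositional using (_∈_)
open import Data.List.Relation.Unary.Unique.Propositional using (Unique)
open import Data.Product using (Σ; _×_; ∃)
open import Relation.Nullary using (¬_)
open import Relation.Binary.PropositionalEquality using (_≡_)
open import Function.Bundles using (_⇔_)

-- Finite cardinality: a predicate P on A has exactly n elements if some
-- duplicate-free list of length n has exactly the elements satisfying P.
Enumerates : {A : Set} → (A → Set) → List A → Set
Enumerates {A} P l = Unique l × ((x : A) → (x ∈ l) ⇔ P x)

_HasSize_ : {A : Set} → (A → Set) → ℕ → Set
_HasSize_ {A} P n = Σ (List A) λ l → Enumerates P l × length l ≡ n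

∣_∣ᵥ : {d : ℕ} → Vec ℕ d → ℕ
∣ x ∣ᵥ = foldr _ _+_ 0 x

_≤ᵥ_ : {d : ℕ} → Vec ℕ d → Vec ℕ d → Set
x ≤ᵥ y = Pointwise _≤_ x y

record IsNumericalSemigroup (T : ℕ → Set) : Set where
  field
    zero∈ : T 0
    +-closed : ∀ {a b} → T a → T b → T (a + b)
    cofinite : ∃ λ F → ∀ n → F < n → T n

N₁ : (ℕ → Set) → ℕ → Set
N₁ T s = T s × ∃ λ h → ¬ T h × s ≤ h

N : {d : ℕ} → (Vec ℕ d → Set) → Vec ℕ d → Set
N S s = S s × ∃ λ h → ¬ S h × s ≤ᵥ h

graded : (T : ℕ → Set) (d : ℕ) → Vec ℕ d → Set
graded T d a = T ∣ a ∣ᵥ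

G : (d k : ℕ) → Vec ℕ d → Set
G d k x = ∣ x ∣ᵥ ≡ k

-- A vector z lies below a gap of S exactly when |z| lies below a gap of T:
-- taking sizes maps gaps of S to gaps of T, and conversely z can be raised in
-- its first coordinate (this is where d ≥ 1 is needed) until its size is a given
-- gap of T. So N(S) is the disjoint union of the slices G_k over k ∈ N(T), and
-- its size is the sum of the slice sizes.
module Submission where

open import Defs
open import Data.Nat using (ℕ; suc; _+_; _∸_; _≤_; z≤n)
open import Data.Nat.Properties using (+-mono-≤; m+n≤o⇒m≤o∸n; m∸n+n≡m; ≤-refl; ≤-trans; m≤n+m)
open import Data.Nat.ListAction using (sum)
open import Data.Vec using (Vec; _∷_; [])
import Data.Vec.Relation.Binary.Pointwise.Inductive as Pointwise
open Pointwise using ([]; _∷_)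
open import Data.List using (List; []; _∷_; length; map; concatMap)
open import Data.List.Membership.Propositional using (_∈_)
open import Data.List.Relation.Binary.Disjoint.Propositional using (Disjoint)
open import Data.List.Relation.Unary.Unique.Propositional using (Unique)
open import Data.List.Properties using (length-++)
open import Data.List.Membership.Propositional.Properties using (∈-concatMap⁺; ∈-concatMap⁻)
open import Data.List.Membership.Propositional.Properties.WithK using (unique∧set⇒bag)
open import Data.List.Relation.Binary.BagAndSetEquality using (∼bag⇒↭)
open import Data.List.Relation.Binary.Permutation.Propositional.Properties using (↭-length)
import Data.List.Relation.Unary.Any as Any
import Data.List.Relation.Unary.All as All
import Data.List.Relation.Unary.All.Properties as All
import Data.List.Relation.Unary.AllPairs as AllPairs
import Data.List.Relation.Unary.AllPairs.Properties as AllPairs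
import Data.List.Relation.Unary.Unique.Propositional.Properties as Unique
open import Data.Product using (_×_; _,_; ∃)
open import Relation.Nullary using (¬_)
open import Function.Bundles using (_⇔_; mk⇔; Equivalence)
import Function.Properties.Equivalence as ⇔
open import Relation.Binary.PropositionalEquality using (_≡_; refl; sym; trans; cong₂; subst)

open Equivalence

HasSize-unique : {A : Set} {P : A → Set} {m n : ℕ} → P HasSize m → P HasSize n → m ≡ n
HasSize-unique (l , (l! , l∈) , refl) (l′ , (l′! , l′∈) , refl) =
  ↭-length (∼bag⇒↭ (unique∧set⇒bag l! l′! λ {x} → ⇔.trans (l∈ x) (⇔.sym (l′∈ x))))

HasSize-cong : {A : Set} {P Q : A → Set} {n : ℕ} →
               (∀ x → P x ⇔ Q x) → P HasSize n → Q HasSize n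
HasSize-cong P⇔Q (l , (l! , l∈) , ∣l∣) = l , (l! , λ x → ⇔.trans (l∈ x) (P⇔Q x)) , ∣l∣

module _ {A B : Set} (f : A → B) {g : B → ℕ}
         (fibre-size : (b : B) → (λ x → f x ≡ b) HasSize g b) where

  private
    fibre : B → List A
    fibre b = let l , _ = fibre-size b in l

    unique-fibre : (b : B) → Unique (fibre b)
    unique-fibre b = let _ , (l! , _) , _ = fibre-size b in l!

    ∈-fibre : (b : B) (x : A) → x ∈ fibre b ⇔ f x ≡ b
    ∈-fibre b = let _ , (_ , l∈) , _ = fibre-size b in l∈

    length-fibre : (b : B) → length (fibre b) ≡ g b
    length-fibre b = let _ , _ , ∣l∣ = fibre-size b in ∣l∣

    length-concatMap-fibre : (K : List B) → length (concatMap fibre K) ≡ sum (map g K)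
    length-concatMap-fibre [] = refl
    length-concatMap-fibre (b ∷ K) =
      trans (length-++ (fibre b)) (cong₂ _+_ (length-fibre b) (length-concatMap-fibre K))

    ∈-concatMap-fibre : (K : List B) (x : A) → x ∈ concatMap fibre K ⇔ f x ∈ K
    ∈-concatMap-fibre K x = mk⇔
      (λ x∈ → Any.map (λ {b} → to (∈-fibre b x)) (∈-concatMap⁻ fibre x∈))
      (λ fx∈ → ∈-concatMap⁺ fibre (Any.map (λ {b} → from (∈-fibre b x)) fx∈))

    unique-concatMap-fibre : {K : List B} → Unique K → Unique (concatMap fibre K)
    unique-concatMap-fibre K! =
      Unique.concat⁺
        (All.map⁺ (All.universal unique-fibre _))
        (AllPairs.map⁺ (AllPairs.map fibres-disjoint K!))
      where
      fibres-disjoint : ∀ {b b′} → ¬ b ≡ b′ → Disjoint (fibre b) (fibre b′)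
      fibres-disjoint b≢b′ {x} (x∈ , x∈′) =
        b≢b′ (trans (sym (to (∈-fibre _ x) x∈)) (to (∈-fibre _ x) x∈′))

  HasSize-preimage : {R : B → Set} {K : List B} →
                     Enumerates R K → (λ x → R (f x)) HasSize sum (map g K)
  HasSize-preimage {K = K} (K! , K∈) =
    concatMap fibre K ,
    (unique-concatMap-fibre K! , λ x → ⇔.trans (∈-concatMap-fibre K x) (K∈ (f x))) ,
    length-concatMap-fibre K

∣∣ᵥ-mono : {d : ℕ} {x y : Vec ℕ d} → x ≤ᵥ y → ∣ x ∣ᵥ ≤ ∣ y ∣ᵥ
∣∣ᵥ-mono [] = z≤n
∣∣ᵥ-mono (x≤y ∷ xs≤ys) = +-mono-≤ x≤y (∣∣ᵥ-mono xs≤ys)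

≤ᵥ-raise-to-size : {d : ℕ} {n : ℕ} (x : Vec ℕ (suc d)) → ∣ x ∣ᵥ ≤ n →
                   ∃ λ y → x ≤ᵥ y × ∣ y ∣ᵥ ≡ n
≤ᵥ-raise-to-size {n = n} (x ∷ xs) x+∣xs∣≤n =
  (n ∸ ∣ xs ∣ᵥ) ∷ xs ,
  m+n≤o⇒m≤o∸n x x+∣xs∣≤n ∷ Pointwise.refl ≤-refl ,
  m∸n+n≡m (≤-trans (m≤n+m ∣ xs ∣ᵥ x) x+∣xs∣≤n)

N-graded⇔N₁ : (T : ℕ → Set) {d : ℕ} → 1 ≤ d →
              (z : Vec ℕ d) → N (graded T d) z ⇔ N₁ T ∣ z ∣ᵥ
N-graded⇔N₁ T {suc d} _ z = mk⇔
  (λ { (Tz , h , ¬Th , z≤h) → Tz , ∣ h ∣ᵥ , ¬Th , ∣∣ᵥ-mono z≤h })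
  (λ { (Tz , k , ¬Tk , ∣z∣≤k) → let h , z≤h , ∣h∣≡k = ≤ᵥ-raise-to-size z ∣z∣≤k in
       Tz , h , (λ Th → ¬Tk (subst T ∣h∣≡k Th)) , z≤h })

proposition4p6 : (T : ℕ → Set) → IsNumericalSemigroup T → (d : ℕ) → 1 ≤ d →
    (nS : ℕ) → N (graded T d) HasSize nS →
    (NT : List ℕ) → Enumerates (N₁ T) NT →
    (g : ℕ → ℕ) → ((k : ℕ) → G d k HasSize g k) →
    nS ≡ sum (map g NT)
proposition4p6 T _ d 1≤d nS N[S]-size NT NT-enumerates g G-size =
  HasSize-unique N[S]-size
    (HasSize-cong (λ z → ⇔.sym (N-graded⇔N₁ T 1≤d z))
      (HasSize-preimage ∣_∣ᵥ G-size NT-enumerates))
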